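{- If $A=\{1,2,\dots,n\}$, then $\mathcal{C}_A(\mu)=\mathcal{B}(\mu)$ for every partition $\mu$ of $n$.
   Context: A word on $\{0,1,2,\dots\}$ is Yamanouchi if every suffix contains at least as many $i$'s as $(i+1)$'s for all $i\ge0$; it has content $\mu$ if exactly $\mu_i$ letters equal $i-1$. A word $w_1\cdots w_n$ is $\mu$-sub-Yamanouchi if there is a Yamanouchi word $v$ of content $\mu$ with $w_i\le v_i$ for all $i$. The monomial of $c=c_1\cdots c_n$ is $x^c=x_n^{c_1}\cdots x_1^{c_n}$. For $A=\{1,\dots,n\}$ (no repeated letters), $\mathcal{C}_A(\mu)$ is the set of monomials $x^c$ of $\mu$-sub-Yamanouchi words $c$ of length $n$. The Garsia–Procesi sets $\mathcal{B}(\mu)$ are defined by $\mathcal{B}((1))=\{1\}$ and, for $|\mu|=n\ge2$, $\mathcal{B}(\mu)=\bigsqcup_{i=1}^{\ell(\mu)}x_n^{i-1}\cdot\mathcal{B}(\mu^{(i)})$, where $\ell(\mu)$ is the number of parts, $\mu^{(i)}$ is obtained from $\mu$ by removing the top cell of the column containing the last cell of row $i$, and $m\cdot\mathcal{B}=\{mb:b\in\mathcal{B}\}$. -}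

module Defs where

open import Data.Nat using (ℕ; zero; suc; _+_; _∸_; _≤_; _<_)
open import Data.List using (List; []; _∷_; _++_; [_]; length; drop; reverse)
open import Data.Nat.ListAction using (sum)
open import Data.List.Relation.Unary.All using (All)
open import Data.List.Relation.Unary.Linked using (Linked)
open import Data.List.Relation.Binary.Pointwise using (Pointwise)
open import Data.Product using (Σ; _×_)
open import Relation.Binary.PropositionalEquality using (_≡_)
import Data.Nat
import Relation.Nullary

-- Words are lists of natural numbers (letters 0,1,2,...).

count : ℕ → List ℕ → ℕ
count j [] = 0
count j (x ∷ xs) with Data.Nat._≟_ x j
... | Relation.Nullary.yes _ = suc (count j xs)
... | Relation.Nullary.no _ = count j xs

IsPartition : List ℕ → Set
IsPartition μ = Linked (λ a b → b ≤ a) μ × All (λ a → 0 < a) μ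

size : List ℕ → ℕ
size = sum

-- μ_(j+1) (0-indexed access), with μ_i = 0 beyond the last part
partAt : List ℕ → ℕ → ℕ
partAt [] j = 0
partAt (x ∷ xs) zero = x
partAt (x ∷ xs) (suc j) = partAt xs j

Yamanouchi : List ℕ → Set
Yamanouchi v = ∀ (k i : ℕ) → count (suc i) (drop k v) ≤ count i (drop k v)

HasContent : List ℕ → List ℕ → Set
HasContent μ v = ∀ (j : ℕ) → count j v ≡ partAt μ j

SubYamanouchi : List ℕ → List ℕ → Set
SubYamanouchi μ w =
  Σ (List ℕ) (λ v → Yamanouchi v × HasContent μ v × Pointwise _≤_ w v)

-- Monomials in x₁,...,x_n are represented by exponent vectors (e₁,...,e_n).
-- x^c = x_n^{c₁} ⋯ x₁^{c_n} has exponent vector reverse c.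
monomial : List ℕ → List ℕ
monomial c = reverse c

InC : List ℕ → List ℕ → Set
InC μ e = Σ (List ℕ) (λ c → length c ≡ size μ × SubYamanouchi μ c × e ≡ monomial c)

-- height of column c (1-indexed column): number of parts ≥ c
colHeight : ℕ → List ℕ → ℕ
colHeight c [] = 0
colHeight c (x ∷ xs) with Data.Nat._≤?_ c x
... | Relation.Nullary.yes _ = suc (colHeight c xs)
... | Relation.Nullary.no _ = colHeight c xs

decAt : ℕ → List ℕ → List ℕ
decAt h [] = []
decAt zero (x ∷ xs) = (x ∸ 1) ∷ xs
decAt (suc h) (x ∷ xs) = x ∷ decAt h xs

dropZeros : List ℕ → List ℕ
dropZeros [] = []
dropZeros (zero ∷ xs) = dropZeros xs
dropZeros (suc x ∷ xs) = suc x ∷ dropZeros xs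

-- μ^(i+1) (0-indexed i): remove the top cell of the column containing the
-- last cell of row i+1, i.e. column c = μ_(i+1); its top cell lies in row
-- colHeight c μ (1-indexed), i.e. 0-indexed row colHeight c μ ∸ 1.
removeCell : List ℕ → ℕ → List ℕ
removeCell μ i = dropZeros (decAt (colHeight (partAt μ i) μ ∸ 1) μ)

-- Membership in the Garsia–Procesi set 𝓑(μ) (exponent vectors (e₁,...,e_n)).
-- 𝓑((1)) = {1};  for |μ| ≥ 2,  𝓑(μ) = ⋃_{i=1}^{ℓ(μ)} x_n^{i-1} 𝓑(μ^(i)).
data InB : List ℕ → List ℕ → Set where
  base : InB (1 ∷ []) (0 ∷ [])
  step : ∀ (μ : List ℕ) (i : ℕ) (e : List ℕ) →
         2 ≤ size μ → i < length μ →
         InB (removeCell μ i) e → InB μ (e ++ [ i ])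

-- A witness v for a μ-sub-Yamanouchi word c₁ c₂ ⋯ starts with a letter j ≥ c₁
-- at which μ has a removable corner (row j + 1 strictly longer than row j + 2),
-- and the rest of c is sub-Yamanouchi for μ with that cell removed.  Such a
-- corner may be traded for any smaller corner index that is still ≥ c₁
-- (exchange), so one may take the least one: the row of the top cell of the
-- column ending row c₁ + 1, which is exactly the cell removed in μ^(c₁+1).
-- Peeling off c₁ therefore follows the recursion 𝓑(μ) = ⊔ x_n^(i-1) 𝓑(μ^(i)),
-- with c₁ as the exponent of x_n.
module Submission where

open import Defs
open import Data.Nat using (ℕ; zero; suc; _+_; _∸_; _≤_; _<_; _≥_; z≤n; s≤s; _≟_; _≤?_; _<?_)
open import Data.Nat.Properties
open import Data.Nat.ListAction using (sum)
open import Data.List using (List; []; _∷_; [_]; length; reverse)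
open import Data.List.Properties using (unfold-reverse)
open import Data.List.Relation.Binary.Pointwise using (Pointwise; []; _∷_)
open import Data.List.Relation.Unary.All using (All; []; _∷_)
open import Data.List.Relation.Unary.Linked using (Linked; []; [-]; _∷_)
import Data.List.Relation.Unary.Linked as Linked
open import Data.Product using (Σ; ∃-syntax; _×_; _,_; proj₁)
open import Data.Sum using (inj₁; inj₂)
open import Data.Empty using (⊥-elim)
open import Function using (_∘_)
open import Relation.Nullary using (yes; no; ¬_)
open import Relation.Binary.PropositionalEquality hiding ([_])

open ≤-Reasoning

-- A content or partition μ is handled as the function partAt μ : i ↦ μ_(i+1).

Shape : Set
Shape = ℕ → ℕ

Decreasing : Shape → Set
Decreasing f = ∀ i → f (suc i) ≤ f i

record Corner (f : Shape) (j : ℕ) : Set where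
  constructor corner
  field descent : f (suc j) < f j

open Corner using (descent)

δ : ℕ → ℕ → ℕ
δ zero    zero    = 1
δ zero    (suc j) = 0
δ (suc i) zero    = 0
δ (suc i) (suc j) = δ i j

δ-refl : ∀ i → δ i i ≡ 1
δ-refl zero    = refl
δ-refl (suc i) = δ-refl i

δ-≢ : ∀ {i j} → i ≢ j → δ i j ≡ 0
δ-≢ {zero}  {zero}  i≢j = ⊥-elim (i≢j refl)
δ-≢ {zero}  {suc j} _   = refl
δ-≢ {suc i} {zero}  _   = refl
δ-≢ {suc i} {suc j} i≢j = δ-≢ (i≢j ∘ cong suc)

decAtᶠ : ℕ → Shape → Shape
decAtᶠ j f i = f i ∸ δ i j

decAtᶠ-here : ∀ j f → decAtᶠ j f j ≡ f j ∸ 1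
decAtᶠ-here j f = cong (f j ∸_) (δ-refl j)

decAtᶠ-there : ∀ {i j} f → i ≢ j → decAtᶠ j f i ≡ f i
decAtᶠ-there {i} f i≢j = cong (f i ∸_) (δ-≢ i≢j)

decAtᶠ-≤ : ∀ j f i → decAtᶠ j f i ≤ f i
decAtᶠ-≤ j f i = m∸n≤m (f i) (δ i j)

decAtᶠ-comm : ∀ x y f → decAtᶠ x (decAtᶠ y f) ≗ decAtᶠ y (decAtᶠ x f)
decAtᶠ-comm x y f i = begin-equality
  f i ∸ δ i y ∸ δ i x   ≡⟨ ∸-+-assoc (f i) (δ i y) (δ i x) ⟩
  f i ∸ (δ i y + δ i x) ≡⟨ cong (f i ∸_) (+-comm (δ i y) (δ i x)) ⟩
  f i ∸ (δ i x + δ i y) ≡⟨ ∸-+-assoc (f i) (δ i x) (δ i y) ⟨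
  f i ∸ δ i x ∸ δ i y   ∎

δ+decAtᶠ : ∀ {f j} i → 1 ≤ f j → δ i j + decAtᶠ j f i ≡ f i
δ+decAtᶠ {f} {j} i 1≤fj with i ≟ j
... | yes refl = m+[n∸m]≡n (subst (_≤ f i) (sym (δ-refl i)) 1≤fj)
... | no i≢j   = m+[n∸m]≡n (subst (_≤ f i) (sym (δ-≢ i≢j)) z≤n)

decreasing-≗ : ∀ {f g} → f ≗ g → Decreasing f → Decreasing g
decreasing-≗ f≗g d i = subst₂ _≤_ (f≗g (suc i)) (f≗g i) (d i)

decreasing-antitone : ∀ {f i k} → Decreasing f → i ≤ k → f k ≤ f i
decreasing-antitone {k = zero}  d z≤n     = ≤-refl
decreasing-antitone {k = suc k} d z≤n     = ≤-trans (d k) (decreasing-antitone d z≤n)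
decreasing-antitone             d (s≤s p) = decreasing-antitone (d ∘ suc) p

corner⇒pos : ∀ {f j} → Corner f j → 1 ≤ f j
corner⇒pos c = ≤-trans (s≤s z≤n) (descent c)

decAtᶠ-decreasing : ∀ {f j} → Decreasing f → Corner f j → Decreasing (decAtᶠ j f)
decAtᶠ-decreasing {f} {j} d c i with i ≟ j
... | yes refl = begin
  decAtᶠ i f (suc i) ≡⟨ decAtᶠ-there f 1+n≢n ⟩
  f (suc i)          ≤⟨ <⇒≤pred (descent c) ⟩
  f i ∸ 1            ≡⟨ decAtᶠ-here i f ⟨
  decAtᶠ i f i       ∎
... | no i≢j = begin
  decAtᶠ j f (suc i) ≤⟨ decAtᶠ-≤ j f (suc i) ⟩
  f (suc i)          ≤⟨ d i ⟩
  f i                ≡⟨ decAtᶠ-there f i≢j ⟨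
  decAtᶠ j f i       ∎

decAtᶠ-corner : ∀ {f x y} → Corner f y → y ≢ x → Corner (decAtᶠ x f) y
decAtᶠ-corner {f} {x} {y} c y≢x = corner (begin-strict
  decAtᶠ x f (suc y) ≤⟨ decAtᶠ-≤ x f (suc y) ⟩
  f (suc y)          <⟨ descent c ⟩
  f y                ≡⟨ decAtᶠ-there f y≢x ⟨
  decAtᶠ x f y       ∎)

corner-created : ∀ {f x r} → Corner (decAtᶠ x f) r → ¬ Corner f r → x ≡ suc r
corner-created {f} {x} {r} c ¬c with x ≟ suc r
... | yes x≡1+r = x≡1+r
... | no x≢1+r  = ⊥-elim (¬c (corner (begin-strict
  f (suc r)          ≡⟨ decAtᶠ-there f (x≢1+r ∘ sym) ⟨
  decAtᶠ x f (suc r) <⟨ descent c ⟩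
  decAtᶠ x f r       ≤⟨ decAtᶠ-≤ x f r ⟩
  f r                ∎)))

-- SubYamanouchi μ is definitionally SubYamanouchiᶠ (partAt μ).
SubYamanouchiᶠ : Shape → List ℕ → Set
SubYamanouchiᶠ f w =
  Σ (List ℕ) λ v → Yamanouchi v × (∀ j → count j v ≡ f j) × Pointwise _≤_ w v

subYamanouchiᶠ-≗ : ∀ {f g w} → f ≗ g → SubYamanouchiᶠ f w → SubYamanouchiᶠ g w
subYamanouchiᶠ-≗ f≗g (v , yam , content , w≤v) = v , yam , (λ j → trans (content j) (f≗g j)) , w≤v

count-∷ : ∀ i j v → count i (j ∷ v) ≡ δ i j + count i v
count-∷ i j v with j ≟ i
... | yes refl = cong (_+ count i v) (sym (δ-refl i))
... | no j≢i   = cong (_+ count i v) (sym (δ-≢ (j≢i ∘ sym)))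

∷-subYamanouchiᶠ : ∀ {f j a w} → Decreasing f → Corner f j → a ≤ j →
                   SubYamanouchiᶠ (decAtᶠ j f) w → SubYamanouchiᶠ f (a ∷ w)
∷-subYamanouchiᶠ {f} {j} d c a≤j (v , yam , content , w≤v) =
  j ∷ v , yam′ , content′ , a≤j ∷ w≤v
  where
  content′ : ∀ i → count i (j ∷ v) ≡ f i
  content′ i = begin-equality
    count i (j ∷ v)       ≡⟨ count-∷ i j v ⟩
    δ i j + count i v     ≡⟨ cong (δ i j +_) (content i) ⟩
    δ i j + decAtᶠ j f i  ≡⟨ δ+decAtᶠ i (corner⇒pos c) ⟩
    f i                   ∎
  yam′ : Yamanouchi (j ∷ v)
  yam′ zero    i = subst₂ _≤_ (sym (content′ (suc i))) (sym (content′ i)) (d i)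
  yam′ (suc k) i = yam k i

∷-subYamanouchiᶠ⁻ : ∀ {f a w} → SubYamanouchiᶠ f (a ∷ w) →
                    ∃[ j ] a ≤ j × Corner f j × SubYamanouchiᶠ (decAtᶠ j f) w
∷-subYamanouchiᶠ⁻ {f} (j ∷ v , yam , content , a≤j ∷ w≤v) =
  j , a≤j , corner-j , (v , yam ∘ suc , content′ , w≤v)
  where
  split : ∀ i → δ i j + count i v ≡ f i
  split i = trans (sym (count-∷ i j v)) (content i)
  content′ : ∀ i → count i v ≡ decAtᶠ j f i
  content′ i = begin-equality
    count i v                 ≡⟨ m+n∸m≡n (δ i j) (count i v) ⟨
    δ i j + count i v ∸ δ i j ≡⟨ cong (_∸ δ i j) (split i) ⟩
    f i ∸ δ i j               ∎
  corner-j : Corner f j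
  corner-j = corner (begin-strict
    f (suc j)                     ≡⟨ split (suc j) ⟨
    δ (suc j) j + count (suc j) v ≡⟨ cong (_+ count (suc j) v) (δ-≢ (1+n≢n {j})) ⟩
    count (suc j) v               ≤⟨ yam 1 j ⟩
    count j v                     <⟨ n<1+n (count j v) ⟩
    suc (count j v)               ≡⟨ cong (_+ count j v) (δ-refl j) ⟨
    δ j j + count j v             ≡⟨ split j ⟩
    f j                           ∎)

∷-subYamanouchiᶠ-swap : ∀ {γ x y b w} → Decreasing γ → Corner γ x → Corner γ y → x ≢ y → b ≤ x →
                        SubYamanouchiᶠ (decAtᶠ y (decAtᶠ x γ)) w →
                        SubYamanouchiᶠ (decAtᶠ y γ) (b ∷ w)
∷-subYamanouchiᶠ-swap {γ} {x} {y} d cx cy x≢y b≤x s =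
  ∷-subYamanouchiᶠ (decAtᶠ-decreasing d cy) (decAtᶠ-corner cx x≢y) b≤x
    (subYamanouchiᶠ-≗ (decAtᶠ-comm y x γ) s)

-- The first letter x of the witness is replaced by y; if the next letter r of
-- the witness only became a corner by removing x, the exchange is pushed one
-- letter further with r in the role of x.
exchange : ∀ {γ x y} w → Decreasing γ → Corner γ x → Corner γ y → y < x →
           SubYamanouchiᶠ (decAtᶠ x γ) w → SubYamanouchiᶠ (decAtᶠ y γ) w
exchange {γ} {x} {y} [] d cx cy y<x ([] , _ , content , []) =
  ⊥-elim (<⇒≢ (corner⇒pos cy) (trans (content y) (decAtᶠ-there γ (<⇒≢ y<x))))
exchange {γ} {x} {y} (b ∷ w) d cx cy y<x s with ∷-subYamanouchiᶠ⁻ s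
... | r , b≤r , cr′ , s′ with r ≟ y
...   | yes refl = ∷-subYamanouchiᶠ-swap d cx cy (<⇒≢ y<x ∘ sym) (≤-trans b≤r (<⇒≤ y<x)) s′
...   | no r≢y with γ (suc r) <? γ r
...     | yes r-descent = ∷-subYamanouchiᶠ-swap d cr cy r≢y b≤r
                     (exchange w (decAtᶠ-decreasing d cr) cx′ (decAtᶠ-corner cy (r≢y ∘ sym)) y<x
                       (subYamanouchiᶠ-≗ (decAtᶠ-comm r x γ) s′))
  where
  cr : Corner γ r
  cr = corner r-descent
  cx′ : Corner (decAtᶠ r γ) x
  cx′ with x ≟ r
  ... | yes refl = cr′
  ... | no x≢r   = decAtᶠ-corner cx x≢r
...     | no ¬r-descent with corner-created cr′ (¬r-descent ∘ descent)
...       | refl = ∷-subYamanouchiᶠ-swap d cx cy (<⇒≢ y<x ∘ sym) (m≤n⇒m≤1+n b≤r)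
                     (exchange w (decAtᶠ-decreasing d cx) cr′ (decAtᶠ-corner cy (<⇒≢ y<x)) y<r s′)
  where
  y<r : y < r
  y<r = ≤∧≢⇒< (≤-pred y<x) (r≢y ∘ sym)

decreasing-partAt : ∀ {l} → Linked _≥_ l → Decreasing (partAt l)
decreasing-partAt []         i       = z≤n
decreasing-partAt [-]        i       = z≤n
decreasing-partAt (x≥y ∷ _)  zero    = x≥y
decreasing-partAt (_ ∷ y∷ys) (suc i) = decreasing-partAt y∷ys i

decreasing⇒linked : ∀ l → Decreasing (partAt l) → Linked _≥_ l
decreasing⇒linked []           d = []
decreasing⇒linked (x ∷ [])     d = [-]
decreasing⇒linked (x ∷ y ∷ ys) d = d 0 ∷ decreasing⇒linked (y ∷ ys) (d ∘ suc)

partAt-positive : ∀ {l i} → All (0 <_) l → i < length l → 1 ≤ partAt l i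
partAt-positive {i = zero}  (x>0 ∷ _)   _       = x>0
partAt-positive {i = suc i} (_ ∷ xs>0) (s≤s i<n) = partAt-positive xs>0 i<n

partAt-positive⁻ : ∀ {l i} → 1 ≤ partAt l i → i < length l
partAt-positive⁻ {x ∷ xs} {zero}  _ = s≤s z≤n
partAt-positive⁻ {x ∷ xs} {suc i} p = s≤s (partAt-positive⁻ {xs} p)

partAt-decAt : ∀ h l → partAt (decAt h l) ≗ decAtᶠ h (partAt l)
partAt-decAt h       []       i       = sym (0∸n≡0 (δ i h))
partAt-decAt zero    (x ∷ xs) zero    = refl
partAt-decAt zero    (x ∷ xs) (suc i) = refl
partAt-decAt (suc h) (x ∷ xs) zero    = refl
partAt-decAt (suc h) (x ∷ xs) (suc i) = partAt-decAt h xs i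

partAt-dropZeros : ∀ l → Decreasing (partAt l) → partAt (dropZeros l) ≗ partAt l
partAt-dropZeros []           d i       = refl
partAt-dropZeros (zero ∷ xs)  d i       =
  trans (partAt-dropZeros xs (d ∘ suc) i) (trans (vanishes (suc i)) (sym (vanishes i)))
  where
  vanishes : ∀ k → partAt (zero ∷ xs) k ≡ 0
  vanishes k = n≤0⇒n≡0 (decreasing-antitone {k = k} d z≤n)
partAt-dropZeros (suc x ∷ xs) d zero    = refl
partAt-dropZeros (suc x ∷ xs) d (suc i) = partAt-dropZeros xs (d ∘ suc) i

dropZeros-positive : ∀ l → All (0 <_) (dropZeros l)
dropZeros-positive []           = []
dropZeros-positive (zero ∷ xs)  = dropZeros-positive xs
dropZeros-positive (suc x ∷ xs) = s≤s z≤n ∷ dropZeros-positive xs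

sum-dropZeros : ∀ l → sum (dropZeros l) ≡ sum l
sum-dropZeros []           = refl
sum-dropZeros (zero ∷ xs)  = sum-dropZeros xs
sum-dropZeros (suc x ∷ xs) = cong (suc x +_) (sum-dropZeros xs)

suc-sum-decAt : ∀ h l → 1 ≤ partAt l h → suc (sum (decAt h l)) ≡ sum l
suc-sum-decAt zero    (suc x ∷ xs) _ = refl
suc-sum-decAt (suc h) (x ∷ xs)     p =
  trans (sym (+-suc x (sum (decAt h xs)))) (cong (x +_) (suc-sum-decAt h xs p))

size≡1 : ∀ {μ} → IsPartition μ → size μ ≡ 1 → μ ≡ [ 1 ]
size≡1 {suc zero ∷ []}          _                 _  = refl
size≡1 {zero ∷ _}               (_ , () ∷ _)      _
size≡1 {suc zero ∷ zero ∷ _}    (_ , _ ∷ () ∷ _)  _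

colHeight-sound : ∀ {c i} l → Linked _≥_ l → i < colHeight c l → c ≤ partAt l i
colHeight-sound {c} {i} (x ∷ xs) lk i<h with c ≤? x
colHeight-sound {i = zero}  (x ∷ xs) lk i<h       | yes c≤x = c≤x
colHeight-sound {i = suc i} (x ∷ xs) lk (s≤s i<h) | yes c≤x = colHeight-sound xs (Linked.tail lk) i<h
... | no c≰x = ⊥-elim (c≰x (≤-trans (colHeight-sound xs (Linked.tail lk) i<h)
                                     (decreasing-antitone (decreasing-partAt lk) (z≤n {suc i}))))

colHeight-complete : ∀ {c i} l → Linked _≥_ l → 1 ≤ c → c ≤ partAt l i → i < colHeight c l
colHeight-complete {c} {i} (x ∷ xs) lk 1≤c c≤l with c ≤? x
colHeight-complete {i = zero}  (x ∷ xs) lk 1≤c c≤l | yes _ = s≤s z≤n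
colHeight-complete {i = suc i} (x ∷ xs) lk 1≤c c≤l | yes _ =
  s≤s (colHeight-complete xs (Linked.tail lk) 1≤c c≤l)
... | no c≰x = ⊥-elim (c≰x (≤-trans c≤l (decreasing-antitone {k = i} (decreasing-partAt lk) z≤n)))
colHeight-complete [] _ (s≤s _) ()

-- The 0-indexed row of the top cell of the column containing the last cell of
-- row a + 1; removeCell μ a is dropZeros (decAt (topRow μ a) μ).
topRow : List ℕ → ℕ → ℕ
topRow μ a = colHeight (partAt μ a) μ ∸ 1

record IsTopRow (f : Shape) (a h : ℕ) : Set where
  field
    below       : a ≤ h
    same-length : f h ≡ f a
    corner-at   : Corner f h

topRow-isTopRow : ∀ {μ a} → IsPartition μ → a < length μ → IsTopRow (partAt μ) a (topRow μ a)
topRow-isTopRow {μ} {a} (lk , positive) a<len = record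
  { below = a≤h ; same-length = fh≡fa ; corner-at = corner fH<fh }
  where
  f = partAt μ
  H = colHeight (f a) μ
  h = H ∸ 1
  1≤fa : 1 ≤ f a
  1≤fa = partAt-positive positive a<len
  a<H : a < H
  a<H = colHeight-complete μ lk 1≤fa ≤-refl
  1+h≡H : suc h ≡ H
  1+h≡H = m+[n∸m]≡n (≤-trans (s≤s z≤n) a<H)
  a≤h : a ≤ h
  a≤h = ≤-pred (subst (a <_) (sym 1+h≡H) a<H)
  fh≡fa : f h ≡ f a
  fh≡fa = ≤-antisym (decreasing-antitone (decreasing-partAt lk) a≤h)
                    (colHeight-sound μ lk (subst (h <_) 1+h≡H (n<1+n h)))
  fH<fh : f (suc h) < f h
  fH<fh = begin-strict
    f (suc h) ≡⟨ cong f 1+h≡H ⟩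
    f H       <⟨ ≰⇒> (λ fa≤fH → <-irrefl refl (colHeight-complete μ lk 1≤fa fa≤fH)) ⟩
    f a       ≡⟨ fh≡fa ⟨
    f h       ∎

isTopRow-least : ∀ {f a h j} → Decreasing f → IsTopRow f a h → a ≤ j → Corner f j → h ≤ j
isTopRow-least {f} {a} {h} {j} d t a≤j cj = ≮⇒≥ λ j<h → <-irrefl refl (begin-strict
  f a       ≡⟨ IsTopRow.same-length t ⟨
  f h       ≤⟨ decreasing-antitone d j<h ⟩
  f (suc j) <⟨ descent cj ⟩
  f j       ≤⟨ decreasing-antitone d a≤j ⟩
  f a       ∎)

module _ {μ a} (P : IsPartition μ) (a<len : a < length μ) where

  private
    top : IsTopRow (partAt μ) a (topRow μ a)
    top = topRow-isTopRow P a<len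

    decreasing-decAt : Decreasing (decAtᶠ (topRow μ a) (partAt μ))
    decreasing-decAt = decAtᶠ-decreasing (decreasing-partAt (proj₁ P)) (IsTopRow.corner-at top)

  partAt-removeCell : partAt (removeCell μ a) ≗ decAtᶠ (topRow μ a) (partAt μ)
  partAt-removeCell i = trans (partAt-dropZeros (decAt h μ) decreasing-list i) (partAt-decAt h μ i)
    where
    h = topRow μ a
    decreasing-list : Decreasing (partAt (decAt h μ))
    decreasing-list = decreasing-≗ (sym ∘ partAt-decAt h μ) decreasing-decAt

  removeCell-isPartition : IsPartition (removeCell μ a)
  removeCell-isPartition =
    decreasing⇒linked (removeCell μ a) (decreasing-≗ (sym ∘ partAt-removeCell) decreasing-decAt) ,
    dropZeros-positive (decAt (topRow μ a) μ)

  suc-size-removeCell : suc (size (removeCell μ a)) ≡ size μ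
  suc-size-removeCell = trans (cong suc (sum-dropZeros (decAt (topRow μ a) μ)))
    (suc-sum-decAt (topRow μ a) μ (corner⇒pos (IsTopRow.corner-at top)))

subYamanouchi⇒InB : ∀ {μ} a w → IsPartition μ → suc (length w) ≡ size μ →
                    SubYamanouchi μ (a ∷ w) → InB μ (reverse (a ∷ w))
subYamanouchi⇒InB a [] P len s with size≡1 P (sym len) | ∷-subYamanouchiᶠ⁻ s
... | refl | zero  , z≤n , _ , _ = base
... | refl | suc j , _ , corner () , _
subYamanouchi⇒InB {μ} a (b ∷ w) P len s with ∷-subYamanouchiᶠ⁻ s
... | j , a≤j , cj , s′ = subst (InB μ) (sym (unfold-reverse a (b ∷ w)))
  (step μ a (reverse (b ∷ w)) (subst (2 ≤_) len (s≤s (s≤s z≤n))) a<len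
    (subYamanouchi⇒InB b w (removeCell-isPartition P a<len)
      (suc-injective (trans len (sym (suc-size-removeCell P a<len))))
      (subYamanouchiᶠ-≗ (sym ∘ partAt-removeCell P a<len) s-top)))
  where
  a<len : a < length μ
  a<len = ≤-<-trans a≤j (partAt-positive⁻ {μ} (corner⇒pos cj))
  top : IsTopRow (partAt μ) a (topRow μ a)
  top = topRow-isTopRow P a<len
  d : Decreasing (partAt μ)
  d = decreasing-partAt (proj₁ P)
  s-top : SubYamanouchiᶠ (decAtᶠ (topRow μ a) (partAt μ)) (b ∷ w)
  s-top with m≤n⇒m<n∨m≡n (isTopRow-least d top a≤j cj)
  ... | inj₁ h<j  = exchange (b ∷ w) d cj (IsTopRow.corner-at top) h<j s′
  ... | inj₂ refl = s′

InC⇒InB : ∀ {μ e} → IsPartition μ → 1 ≤ size μ → InC μ e → InB μ e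
InC⇒InB P 1≤size ([] , len , _) = ⊥-elim (<⇒≢ 1≤size len)
InC⇒InB {μ} P 1≤size (a ∷ w , len , s , e≡) = subst (InB μ) (sym e≡) (subYamanouchi⇒InB a w P len s)

InB⇒InC : ∀ {μ e} → IsPartition μ → InB μ e → InC μ e
InB⇒InC P base = 0 ∷ [] , refl , s , refl
  where
  s : SubYamanouchi [ 1 ] [ 0 ]
  s = ∷-subYamanouchiᶠ {j = 0} (decreasing-partAt [-]) (corner (s≤s z≤n)) z≤n
        ([] , (λ { zero _ → z≤n ; (suc _) _ → z≤n }) , (λ { zero → refl ; (suc _) → refl }) , [])
InB⇒InC P (step μ a e _ a<len b) with InB⇒InC (removeCell-isPartition P a<len) b
... | c , len , s , refl =
  a ∷ c , trans (cong suc len) (suc-size-removeCell P a<len) ,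
  ∷-subYamanouchiᶠ (decreasing-partAt (proj₁ P)) (IsTopRow.corner-at top) (IsTopRow.below top)
    (subYamanouchiᶠ-≗ (partAt-removeCell P a<len) s) ,
  sym (unfold-reverse a c)
  where
  top : IsTopRow (partAt μ) a (topRow μ a)
  top = topRow-isTopRow P a<len

mainTheorem10 : ∀ (μ : List ℕ) → IsPartition μ → 1 ≤ size μ →
    ∀ (e : List ℕ) → (InC μ e → InB μ e) × (InB μ e → InC μ e)
mainTheorem10 μ P 1≤size e = InC⇒InB P 1≤size , InB⇒InC P
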